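{- Let $p$ be an odd prime and $\alpha>2/3$. Then there exists a set $S\subseteq\mathbb{F}_p$ with $|S|=\lfloor\alpha p\rfloor$ and $$\Lambda(S)\le\alpha^3\big(1-(1-\alpha)^2/2\big)+O(1/p),$$ where the implied constant is absolute.
   Context: For $S\subseteq\mathbb{F}_p$, $\Lambda(S):=p^{ -2}\sum_{n,d\in\mathbb{F}_p}1_S(n)1_S(n+d)1_S(n+2d)$.
   Formalization: The parameter α ranges over the rationals. -}

module Defs where

open import Data.Nat using (ℕ; NonZero; _+_; _*_; _%_)
open import Data.Nat.DivMod using (m%n<n)
open import Data.Nat.Properties using (m*n≢0)
open import Data.Fin using (Fin; toℕ; fromℕ<)
open import Data.Fin.Subset using (Subset; Side; inside; outside)
open import Data.Vec using (lookup)
open import Data.List using (map; allFin)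
open import Data.Nat.ListAction using (sum)
open import Data.Integer using (+_)
open import Data.Rational using (ℚ; _/_)

-- Addition in F_p, modelled as Fin p with arithmetic mod p.
_⊕_ : ∀ {p} .{{_ : NonZero p}} → Fin p → Fin p → Fin p
_⊕_ {p} a b = fromℕ< (m%n<n (toℕ a + toℕ b) p)

ind : Side → ℕ
ind inside  = 1
ind outside = 0

𝟙 : ∀ {p} → Subset p → Fin p → ℕ
𝟙 S x = ind (lookup S x)

apCount : ∀ {p} .{{_ : NonZero p}} → Subset p → ℕ
apCount {p} S =
  sum (map (λ n → sum (map (λ d → 𝟙 S n * 𝟙 S (n ⊕ d) * 𝟙 S (n ⊕ (d ⊕ d)))
                           (allFin p)))
           (allFin p))

Λ : ∀ {p} .{{_ : NonZero p}} → Subset p → ℚ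
Λ {p} S = (+ apCount S) / (p * p)
  where instance
    nz : NonZero (p * p)
    nz = m*n≢0 p p

{-# OPTIONS --safe #-}
module Submission where

-- Take S = {m, …, p − 1}, an interval of k = ⌊αp⌋ residues, and let N count the pairs (n, d) with
-- n, n + d, n + 2d ∈ S. In the row n = m + j of S (so p = n + e with e = k − j), the differences d
-- sending n + d or n + 2d into the gap [0, m) contain three disjoint windows: d ∈ [e, e + m), where
-- n + d wraps once; about min(e, m)/2 values with n + 2d ∈ [p, p + m); and about min(j, m)/2 values
-- with n + 2d ∈ [2p, 2p + m). Summing over the rows, and using ∑_{j<k} min(j, m) ≥ mk − (m² + m)/2,
-- gives 2N + 4pk ≤ 5k² + p² + p + k, i.e. 2Λ(S) ≤ 5x² − 4x + 1 + O(1/p) for x = k/p ∈ [α − 1/p, α].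
-- Moving x to α costs at most 4/p, and for α ≥ 2/3
--   2α³(1 − (1 − α)²/2) − (5α² − 4α + 1) = (1 − α)³ (3α − 2 + (1 − α)²) ≥ 0.

module Sums where

  open import Data.Nat
  open import Data.Nat.Properties
  open import Data.Product using (∃; _×_; _,_)
  open import Data.Sum using (_⊎_; inj₁; inj₂)
  open import Relation.Binary.PropositionalEquality
  open import Relation.Nullary using (yes; no)
  open import Relation.Nullary.Negation using (contradiction)
  open import Data.Nat.Tactic.RingSolver using (solve-∀)

  ∑ : ℕ → (ℕ → ℕ) → ℕ
  ∑ zero    g = 0
  ∑ (suc n) g = g 0 + ∑ n (λ i → g (suc i))

  syntax ∑ n (λ i → e) = ∑[ i < n ] e

  ∑-cong : ∀ n {f g : ℕ → ℕ} → (∀ i → i < n → f i ≡ g i) → ∑ n f ≡ ∑ n g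
  ∑-cong zero    eq = refl
  ∑-cong (suc n) eq = cong₂ _+_ (eq 0 z<s) (∑-cong n (λ i i<n → eq (suc i) (s<s i<n)))

  ∑-mono-≤ : ∀ n {f g : ℕ → ℕ} → (∀ i → i < n → f i ≤ g i) → ∑ n f ≤ ∑ n g
  ∑-mono-≤ zero    le = z≤n
  ∑-mono-≤ (suc n) le = +-mono-≤ (le 0 z<s) (∑-mono-≤ n (λ i i<n → le (suc i) (s<s i<n)))

  ∑-const : ∀ n c → ∑[ _ < n ] c ≡ n * c
  ∑-const zero    c = refl
  ∑-const (suc n) c = cong (c +_) (∑-const n c)

  ∑-zero : ∀ n {g : ℕ → ℕ} → (∀ i → i < n → g i ≡ 0) → ∑ n g ≡ 0
  ∑-zero n eq = trans (∑-cong n eq) (trans (∑-const n 0) (*-zeroʳ n))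

  ∑-≤-length : ∀ n {g : ℕ → ℕ} → (∀ i → i < n → g i ≤ 1) → ∑ n g ≤ n
  ∑-≤-length n le = ≤-trans (∑-mono-≤ n le) (≤-reflexive (trans (∑-const n 1) (*-identityʳ n)))

  ∑-distrib-+ : ∀ n (f g : ℕ → ℕ) → ∑[ i < n ] (f i + g i) ≡ ∑ n f + ∑ n g
  ∑-distrib-+ zero    f g = refl
  ∑-distrib-+ (suc n) f g =
    trans (cong (f 0 + g 0 +_) (∑-distrib-+ n (λ i → f (suc i)) (λ i → g (suc i))))
          (interchange (f 0) (g 0) _ _)
    where
    interchange : ∀ a b c d → a + b + (c + d) ≡ a + c + (b + d)
    interchange = solve-∀

  ∑-distribˡ-* : ∀ n c (g : ℕ → ℕ) → ∑[ i < n ] (c * g i) ≡ c * ∑ n g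
  ∑-distribˡ-* zero    c g = sym (*-zeroʳ c)
  ∑-distribˡ-* (suc n) c g =
    trans (cong (c * g 0 +_) (∑-distribˡ-* n c (λ i → g (suc i)))) (sym (*-distribˡ-+ c (g 0) _))

  ∑-split : ∀ a b (g : ℕ → ℕ) → ∑ (a + b) g ≡ ∑ a g + ∑[ i < b ] g (a + i)
  ∑-split zero    b g = refl
  ∑-split (suc a) b g =
    trans (cong (g 0 +_) (∑-split a b (λ i → g (suc i)))) (sym (+-assoc (g 0) _ _))

  ∑-last : ∀ n (g : ℕ → ℕ) → ∑ (suc n) g ≡ ∑ n g + g n
  ∑-last zero    g = +-comm (g 0) 0
  ∑-last (suc n) g = trans (cong (g 0 +_) (∑-last n (λ i → g (suc i)))) (sym (+-assoc (g 0) _ _))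

  ∑-reverse : ∀ n (g : ℕ → ℕ) → ∑[ i < n ] g (n ∸ i) ≡ ∑[ i < n ] g (suc i)
  ∑-reverse zero    g = refl
  ∑-reverse (suc n) g = begin
    g (suc n) + ∑[ i < n ] g (n ∸ i)      ≡⟨ cong (g (suc n) +_) (∑-reverse n g) ⟩
    g (suc n) + ∑[ i < n ] g (suc i)      ≡⟨ +-comm (g (suc n)) _ ⟩
    ∑[ i < n ] g (suc i) + g (suc n)      ≡⟨ ∑-last n (λ i → g (suc i)) ⟨
    ∑[ i < suc n ] g (suc i)              ∎
    where open ≡-Reasoning

  ∑⊓-below : ∀ m k → k ≤ m → 2 * ∑[ j < k ] (j ⊓ m) + k ≡ k * k
  ∑⊓-below m zero    _      = refl
  ∑⊓-below m (suc k) 1+k≤m = begin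
    2 * ∑[ j < suc k ] (j ⊓ m) + suc k        ≡⟨ cong (λ s → 2 * s + suc k) (∑-last k (_⊓ m)) ⟩
    2 * (∑[ j < k ] (j ⊓ m) + k ⊓ m) + suc k
      ≡⟨ cong (λ v → 2 * (∑[ j < k ] (j ⊓ m) + v) + suc k) (m≤n⇒m⊓n≡m (<⇒≤ 1+k≤m)) ⟩
    2 * (∑[ j < k ] (j ⊓ m) + k) + suc k       ≡⟨ regroup (∑[ j < k ] (j ⊓ m)) k ⟩
    (2 * ∑[ j < k ] (j ⊓ m) + k) + (1 + 2 * k) ≡⟨ cong (_+ (1 + 2 * k)) (∑⊓-below m k (<⇒≤ 1+k≤m)) ⟩
    k * k + (1 + 2 * k)                        ≡⟨ square-suc k ⟩
    suc k * suc k                              ∎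
    where
    open ≡-Reasoning
    regroup : ∀ T k → 2 * (T + k) + suc k ≡ (2 * T + k) + (1 + 2 * k)
    regroup = solve-∀
    square-suc : ∀ k → k * k + (1 + 2 * k) ≡ suc k * suc k
    square-suc = solve-∀

  ∑⊓-above : ∀ m t → 2 * ∑[ j < m + t ] (j ⊓ m) + m ≡ m * m + 2 * m * t
  ∑⊓-above m zero = begin
    2 * ∑[ j < m + 0 ] (j ⊓ m) + m ≡⟨ cong (λ k → 2 * ∑[ j < k ] (j ⊓ m) + m) (+-identityʳ m) ⟩
    2 * ∑[ j < m ] (j ⊓ m) + m     ≡⟨ ∑⊓-below m m ≤-refl ⟩
    m * m                          ≡⟨ +-identityʳ (m * m) ⟨
    m * m + 0                      ≡⟨ cong (m * m +_) (*-zeroʳ (2 * m)) ⟨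
    m * m + 2 * m * 0              ∎
    where open ≡-Reasoning
  ∑⊓-above m (suc t) = begin
    2 * ∑[ j < m + suc t ] (j ⊓ m) + m       ≡⟨ cong (λ k → 2 * ∑[ j < k ] (j ⊓ m) + m) (+-suc m t) ⟩
    2 * ∑[ j < suc (m + t) ] (j ⊓ m) + m     ≡⟨ cong (λ s → 2 * s + m) (∑-last (m + t) (_⊓ m)) ⟩
    2 * (∑[ j < m + t ] (j ⊓ m) + (m + t) ⊓ m) + m
      ≡⟨ cong (λ v → 2 * (∑[ j < m + t ] (j ⊓ m) + v) + m) (m≥n⇒m⊓n≡n (m≤m+n m t)) ⟩
    2 * (∑[ j < m + t ] (j ⊓ m) + m) + m     ≡⟨ regroup (∑[ j < m + t ] (j ⊓ m)) m ⟩
    (2 * ∑[ j < m + t ] (j ⊓ m) + m) + 2 * m ≡⟨ cong (_+ 2 * m) (∑⊓-above m t) ⟩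
    m * m + 2 * m * t + 2 * m                ≡⟨ regroup′ m t ⟩
    m * m + 2 * m * suc t                    ∎
    where
    open ≡-Reasoning
    regroup : ∀ T m → 2 * (T + m) + m ≡ (2 * T + m) + 2 * m
    regroup = solve-∀
    regroup′ : ∀ m t → m * m + 2 * m * t + 2 * m ≡ m * m + 2 * m * suc t
    regroup′ = solve-∀

  2mk≤2∑⊓+m²+m : ∀ m k → 2 * m * k ≤ 2 * ∑[ j < k ] (j ⊓ m) + m * m + m
  2mk≤2∑⊓+m²+m m k with ≤-total k m
  ... | inj₁ k≤m = +-cancelʳ-≤ k _ _ (begin
    2 * m * k + k                     ≡⟨ cong (λ m → 2 * m * k + k) m≡k+t ⟩
    2 * (k + t) * k + k               ≤⟨ m≤m+n _ (t * t + t) ⟩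
    2 * (k + t) * k + k + (t * t + t) ≡⟨ expand k t ⟩
    k * k + (k + t) * (k + t) + (k + t) ≡⟨ cong (λ m → k * k + m * m + m) m≡k+t ⟨
    k * k + m * m + m                 ≡⟨ cong (λ s → s + m * m + m) (∑⊓-below m k k≤m) ⟨
    2 * T + k + m * m + m             ≡⟨ move-k (2 * T) k (m * m) m ⟩
    2 * T + m * m + m + k             ∎)
    where
    open ≤-Reasoning
    T t : ℕ
    T = ∑[ j < k ] (j ⊓ m)
    t = m ∸ k
    m≡k+t : m ≡ k + t
    m≡k+t = sym (m+[n∸m]≡n k≤m)
    expand : ∀ k t → 2 * (k + t) * k + k + (t * t + t) ≡ k * k + (k + t) * (k + t) + (k + t)
    expand = solve-∀
    move-k : ∀ a k b c → a + k + b + c ≡ a + b + c + k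
    move-k = solve-∀
  ... | inj₂ m≤k = ≤-reflexive (begin
    2 * m * k                              ≡⟨ cong (2 * m *_) k≡m+t ⟩
    2 * m * (m + t)                        ≡⟨ expand m t ⟩
    m * m + 2 * m * t + m * m              ≡⟨ cong (_+ m * m) (∑⊓-above m t) ⟨
    2 * ∑[ j < m + t ] (j ⊓ m) + m + m * m ≡⟨ cong (λ k → 2 * ∑[ j < k ] (j ⊓ m) + m + m * m) k≡m+t ⟨
    2 * ∑[ j < k ] (j ⊓ m) + m + m * m     ≡⟨ swap (2 * ∑[ j < k ] (j ⊓ m)) m (m * m) ⟩
    2 * ∑[ j < k ] (j ⊓ m) + m * m + m     ∎)
    where
    open ≡-Reasoning
    t : ℕ
    t = k ∸ m
    k≡m+t : k ≡ m + t
    k≡m+t = sym (m+[n∸m]≡n m≤k)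
    expand : ∀ m t → 2 * m * (m + t) ≡ m * m + 2 * m * t + m * m
    expand = solve-∀
    swap : ∀ a b c → a + b + c ≡ a + c + b
    swap = solve-∀

  interval : ℕ → ℕ → ℕ → ℕ
  interval a l d with a ≤? d | d <? a + l
  ... | yes _ | yes _ = 1
  ... | _     | _     = 0

  interval-inside : ∀ {a l d} → a ≤ d → d < a + l → interval a l d ≡ 1
  interval-inside {a} {l} {d} a≤d d<a+l with a ≤? d | d <? a + l
  ... | yes _   | yes _   = refl
  ... | yes _   | no  d≮ = contradiction d<a+l d≮
  ... | no  a≰d | _       = contradiction a≤d a≰d

  interval-below : ∀ {a l d} → d < a → interval a l d ≡ 0
  interval-below {a} {l} {d} d<a with a ≤? d | d <? a + l
  ... | yes a≤d | yes _ = contradiction a≤d (<⇒≱ d<a)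
  ... | yes _   | no  _ = refl
  ... | no  _   | _     = refl

  interval-above : ∀ {a l d} → a + l ≤ d → interval a l d ≡ 0
  interval-above {a} {l} {d} a+l≤d with a ≤? d | d <? a + l
  ... | yes _ | yes d<a+l = contradiction d<a+l (≤⇒≯ a+l≤d)
  ... | yes _ | no  _     = refl
  ... | no  _ | _         = refl

  interval≤1 : ∀ a l d → interval a l d ≤ 1
  interval≤1 a l d with a ≤? d | d <? a + l
  ... | yes _ | yes _ = ≤-refl
  ... | yes _ | no  _ = z≤n
  ... | no  _ | _     = z≤n

  interval-cases : ∀ a l d → interval a l d ≡ 0 ⊎ ∃ λ u → u < l × a + u ≡ d
  interval-cases a l d with a ≤? d | d <? a + l
  ... | yes a≤d | yes d<a+l = inj₂ (d ∸ a , +-cancelˡ-< a _ l (subst (_< a + l) (sym a+[d∸a]≡d) d<a+l) , a+[d∸a]≡d)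
    where
    a+[d∸a]≡d : a + (d ∸ a) ≡ d
    a+[d∸a]≡d = m+[n∸m]≡n a≤d
  ... | yes _   | no  _     = inj₁ refl
  ... | no  _   | _         = inj₁ refl

  ∑-interval : ∀ n a l → a + l ≤ n → ∑ n (interval a l) ≡ l
  ∑-interval n a l a+l≤n = begin
    ∑ n (interval a l)
      ≡⟨ cong (λ n → ∑ n (interval a l)) (sym (m+[n∸m]≡n a+l≤n)) ⟩
    ∑ (a + l + r) (interval a l)
      ≡⟨ ∑-split (a + l) r _ ⟩
    ∑ (a + l) (interval a l) + ∑[ i < r ] interval a l (a + l + i)
      ≡⟨ cong₂ _+_ (∑-split a l _) (∑-zero r (λ i _ → interval-above (m≤m+n (a + l) i))) ⟩
    ∑ a (interval a l) + ∑[ i < l ] interval a l (a + i) + 0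
      ≡⟨ cong₂ (λ x y → x + y + 0) (∑-zero a (λ _ i<a → interval-below i<a)) inside ⟩
    0 + l + 0
      ≡⟨ +-identityʳ l ⟩
    l ∎
    where
    open ≡-Reasoning
    r : ℕ
    r = n ∸ (a + l)
    inside : ∑[ i < l ] interval a l (a + i) ≡ l
    inside = trans (∑-cong l (λ i i<l → interval-inside (m≤m+n a i) (+-monoʳ-< a i<l)))
                   (trans (∑-const l 1) (*-identityʳ l))

  ∑-+interval : ∀ n (f : ℕ → ℕ) {a l} → a + l ≤ n → ∑[ d < n ] (f d + interval a l d) ≡ ∑ n f + l
  ∑-+interval n f {a} {l} a+l≤n = trans (∑-distrib-+ n f (interval a l)) (cong (∑ n f +_) (∑-interval n a l a+l≤n))

  Vanishes : (ℕ → ℕ) → ℕ → ℕ → Set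
  Vanishes f a l = ∀ u → u < l → f (a + u) ≡ 0

  Vanishes-+ : ∀ {f g a l} → Vanishes f a l → Vanishes g a l → Vanishes (λ d → f d + g d) a l
  Vanishes-+ f0 g0 u u<l = cong₂ _+_ (f0 u u<l) (g0 u u<l)

  interval-vanishes-before : ∀ {a l b l′} → a + l ≤ b → Vanishes (interval b l′) a l
  interval-vanishes-before a+l≤b u u<l = interval-below (<-≤-trans (+-monoʳ-< _ u<l) a+l≤b)

  interval-vanishes-after : ∀ {a l b l′} → b + l′ ≤ a → Vanishes (interval b l′) a l
  interval-vanishes-after b+l′≤a u _ = interval-above (≤-trans b+l′≤a (m≤m+n _ u))

  +interval-≤1 : ∀ {f : ℕ → ℕ} {a l} → (∀ d → f d ≤ 1) → Vanishes f a l →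
                 ∀ d → f d + interval a l d ≤ 1
  +interval-≤1 {f} {a} {l} f≤1 f0 d with interval-cases a l d
  ... | inj₁ out = subst (λ v → f d + v ≤ 1) (sym out) (subst (_≤ 1) (sym (+-identityʳ (f d))) (f≤1 d))
  ... | inj₂ (u , u<l , refl) = subst (λ v → v + interval a l (a + u) ≤ 1) (sym (f0 u u<l)) (interval≤1 a l _)


module Counting where

  open import Data.Nat
  open import Data.Nat.Properties
  open import Data.Nat.DivMod using ([m+kn]%n≡m%n; m<n⇒m%n≡m)
  open import Data.Fin.Subset using (Side; inside; outside)
  open import Relation.Binary.PropositionalEquality
  open import Relation.Nullary using (yes; no)
  open import Relation.Nullary.Negation using (contradiction)
  open import Data.Nat.Tactic.RingSolver using (solve-∀)
  open import Defs using (ind)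
  open Sums

  side≥ : ℕ → ℕ → Side
  side≥ m x with m ≤? x
  ... | yes _ = inside
  ... | no  _ = outside

  χ≥ : ℕ → ℕ → ℕ
  χ≥ m x = ind (side≥ m x)

  χ≥-below : ∀ {m x} → x < m → χ≥ m x ≡ 0
  χ≥-below {m} {x} x<m with m ≤? x
  ... | yes m≤x = contradiction m≤x (<⇒≱ x<m)
  ... | no  _   = refl

  χ≥-above : ∀ {m x} → m ≤ x → χ≥ m x ≡ 1
  χ≥-above {m} {x} m≤x with m ≤? x
  ... | yes _   = refl
  ... | no  m≰x = contradiction m≤x m≰x

  χ≥≤1 : ∀ m x → χ≥ m x ≤ 1
  χ≥≤1 m x with m ≤? x
  ... | yes _ = ≤-refl
  ... | no  _ = z≤n

  %-<-window : ∀ {p m x} .{{_ : NonZero p}} q → m ≤ p → q * p ≤ x → x < q * p + m → x % p < m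
  %-<-window {p} {m} {x} q m≤p lo hi = subst (_< m) (sym x%p≡w) w<m
    where
    w : ℕ
    w = x ∸ q * p
    x≡w+qp : x ≡ w + q * p
    x≡w+qp = sym (m∸n+n≡m lo)
    w<m : w < m
    w<m = +-cancelʳ-< (q * p) w m (subst₂ _<_ x≡w+qp (+-comm (q * p) m) hi)
    x%p≡w : x % p ≡ w
    x%p≡w = trans (cong (_% p) x≡w+qp) (trans ([m+kn]%n≡m%n w q p) (m<n⇒m%n≡m (<-≤-trans w<m m≤p)))

  n≤⌈n/2⌉+⌈n/2⌉ : ∀ n → n ≤ ⌈ n /2⌉ + ⌈ n /2⌉
  n≤⌈n/2⌉+⌈n/2⌉ n = subst (_≤ ⌈ n /2⌉ + ⌈ n /2⌉) (⌊n/2⌋+⌈n/2⌉≡n n)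
                      (+-monoˡ-≤ ⌈ n /2⌉ (⌊n/2⌋≤⌈n/2⌉ n))

  ⌈n/2⌉+⌈n/2⌉≤1+n : ∀ n → ⌈ n /2⌉ + ⌈ n /2⌉ ≤ 1 + n
  ⌈n/2⌉+⌈n/2⌉≤1+n n = subst (⌈ n /2⌉ + ⌈ n /2⌉ ≤_) (cong suc (⌊n/2⌋+⌈n/2⌉≡n n))
                        (+-monoˡ-≤ ⌈ n /2⌉ (⌊n/2⌋-mono (n≤1+n (suc n))))

  ⌊n/2⌋+⌊n/2⌋≤n : ∀ n → ⌊ n /2⌋ + ⌊ n /2⌋ ≤ n
  ⌊n/2⌋+⌊n/2⌋≤n n = subst (⌊ n /2⌋ + ⌊ n /2⌋ ≤_) (⌊n/2⌋+⌈n/2⌉≡n n)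
                      (+-monoʳ-≤ ⌊ n /2⌋ (⌊n/2⌋≤⌈n/2⌉ n))

  n≤1+⌊n/2⌋+⌊n/2⌋ : ∀ n → n ≤ 1 + (⌊ n /2⌋ + ⌊ n /2⌋)
  n≤1+⌊n/2⌋+⌊n/2⌋ n = subst₂ _≤_ (⌊n/2⌋+⌈n/2⌉≡n n) (+-suc ⌊ n /2⌋ ⌊ n /2⌋)
                        (+-monoʳ-≤ ⌊ n /2⌋ (⌊n/2⌋-mono (n≤1+n (suc n))))

  1+[n+n]<m+m : ∀ {n m} → n < m → 1 + (n + n) < m + m
  1+[n+n]<m+m {n} {m} n<m = subst (_≤ m + m) (cong suc (+-suc n n)) (+-mono-≤ n<m n<m)

  ⊓-≤-1+double : ∀ x y {a b} → a ≤ 1 + (x + x) → b ≤ 1 + (y + y) → a ⊓ b ≤ 1 + (x ⊓ y + x ⊓ y)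
  ⊓-≤-1+double x y {a} {b} a≤ b≤ =
    subst (a ⊓ b ≤_) (sym (mono-≤-distrib-⊓ {f = λ t → 1 + (t + t)} (λ t≤t′ → s≤s (+-mono-≤ t≤t′ t≤t′)) x y))
          (⊓-mono-≤ a≤ b≤)

  module Row (p m j e : ℕ) .{{_ : NonZero p}} (p≡m+j+e : p ≡ m + j + e) where

    n h t₁ t₂ s : ℕ
    n = m + j
    h = ⌊ m /2⌋
    t₁ = ⌊ e /2⌋ ⊓ h
    t₂ = ⌈ j /2⌉ ⊓ h
    s = ⌈ j /2⌉ ∸ t₂

    -- The two windows for n + 2d start where n + 2d reaches p (d = ⌈e/2⌉) and end where it reaches
    -- 2p + m (d = m + e + ⌈j/2⌉); capping their lengths by ⌊m/2⌋ keeps n + 2d below p + m resp. above 2p.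

    F : ℕ → ℕ
    F d = χ≥ m ((n + d) % p) * χ≥ m ((n + (d + d)) % p)

    F≤1 : ∀ d → F d ≤ 1
    F≤1 d = *-mono-≤ (χ≥≤1 m _) (χ≥≤1 m _)

    m≤p : m ≤ p
    m≤p = subst (m ≤_) (trans (sym (+-assoc m j e)) (sym p≡m+j+e)) (m≤m+n m (j + e))

    1*p≡n+e : 1 * p ≡ n + e
    1*p≡n+e = trans (*-identityˡ p) p≡m+j+e

    t₁+t₁≤m : t₁ + t₁ ≤ m
    t₁+t₁≤m = ≤-trans (+-mono-≤ (m⊓n≤n ⌊ e /2⌋ h) (m⊓n≤n ⌊ e /2⌋ h)) (⌊n/2⌋+⌊n/2⌋≤n m)

    t₂+t₂≤m : t₂ + t₂ ≤ m
    t₂+t₂≤m = ≤-trans (+-mono-≤ (m⊓n≤n ⌈ j /2⌉ h) (m⊓n≤n ⌈ j /2⌉ h)) (⌊n/2⌋+⌊n/2⌋≤n m)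

    s+t₂≡⌈j/2⌉ : s + t₂ ≡ ⌈ j /2⌉
    s+t₂≡⌈j/2⌉ = m∸n+n≡m (m⊓n≤m ⌈ j /2⌉ h)

    n+d-wraps : Vanishes F e m
    n+d-wraps u u<m = cong (_* χ≥ m ((n + (e + u + (e + u))) % p)) (χ≥-below (%-<-window 1 m≤p lo hi))
      where
      open ≤-Reasoning
      lo : 1 * p ≤ n + (e + u)
      lo = begin
        1 * p       ≡⟨ 1*p≡n+e ⟩
        n + e       ≤⟨ m≤m+n (n + e) u ⟩
        n + e + u   ≡⟨ +-assoc n e u ⟩
        n + (e + u) ∎
      hi : n + (e + u) < 1 * p + m
      hi = begin-strict
        n + (e + u) ≡⟨ +-assoc n e u ⟨
        n + e + u   <⟨ +-monoʳ-< (n + e) u<m ⟩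
        n + e + m   ≡⟨ cong (_+ m) 1*p≡n+e ⟨
        1 * p + m   ∎

    n+2d-wraps-once : Vanishes F ⌈ e /2⌉ t₁
    n+2d-wraps-once u u<t₁ =
      trans (cong (χ≥ m ((n + d) % p) *_) (χ≥-below (%-<-window 1 m≤p lo hi))) (*-zeroʳ (χ≥ m ((n + d) % p)))
      where
      c d : ℕ
      c = ⌈ e /2⌉
      d = c + u
      open ≤-Reasoning
      lo : 1 * p ≤ n + (d + d)
      lo = begin
        1 * p       ≡⟨ 1*p≡n+e ⟩
        n + e       ≤⟨ +-monoʳ-≤ n (n≤⌈n/2⌉+⌈n/2⌉ e) ⟩
        n + (c + c) ≤⟨ +-monoʳ-≤ n (+-mono-≤ (m≤m+n c u) (m≤m+n c u)) ⟩
        n + (d + d) ∎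
      d+d<e+m : d + d < e + m
      d+d<e+m = begin-strict
        d + d                 ≡⟨ regroup c u ⟩
        c + c + (u + u)       <⟨ +-monoʳ-< (c + c) (n<1+n (u + u)) ⟩
        c + c + (1 + (u + u)) ≤⟨ +-monoˡ-≤ _ (⌈n/2⌉+⌈n/2⌉≤1+n e) ⟩
        1 + e + (1 + (u + u)) ≡⟨ +-suc e (1 + (u + u)) ⟨
        e + (2 + (u + u))     ≤⟨ +-monoʳ-≤ e (≤-trans (1+[n+n]<m+m u<t₁) t₁+t₁≤m) ⟩
        e + m                 ∎
        where
        regroup : ∀ c u → c + u + (c + u) ≡ c + c + (u + u)
        regroup = solve-∀
      hi : n + (d + d) < 1 * p + m
      hi = begin-strict
        n + (d + d) <⟨ +-monoʳ-< n d+d<e+m ⟩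
        n + (e + m) ≡⟨ +-assoc n e m ⟨
        n + e + m   ≡⟨ cong (_+ m) 1*p≡n+e ⟨
        1 * p + m   ∎

    n+2d-wraps-twice : Vanishes F (m + e + s) t₂
    n+2d-wraps-twice u u<t₂ =
      trans (cong (χ≥ m ((n + d) % p) *_) (χ≥-below (%-<-window 2 m≤p lo hi))) (*-zeroʳ (χ≥ m ((n + d) % p)))
      where
      c d K : ℕ
      c = ⌈ j /2⌉
      d = m + e + s + u
      K = m + j + e + e + m
      open ≤-Reasoning
      2p≡K+j : ∀ m j e → 2 * (m + j + e) ≡ m + j + e + e + m + j
      2p≡K+j = solve-∀
      2p+m≡K+[j+m] : ∀ m j e → 2 * (m + j + e) + m ≡ m + j + e + e + m + (j + m)
      2p+m≡K+[j+m] = solve-∀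
      n+2d≡K+2[s+u]+m : ∀ m j e s u → m + j + e + e + m + (s + u + (s + u) + m)
                              ≡ m + j + (m + e + s + u + (m + e + s + u))
      n+2d≡K+2[s+u]+m = solve-∀
      j≤2[s+u]+m : j ≤ s + u + (s + u) + m
      j≤2[s+u]+m = begin
        j                   ≤⟨ n≤⌈n/2⌉+⌈n/2⌉ j ⟩
        c + c               ≡⟨ cong₂ _+_ s+t₂≡⌈j/2⌉ s+t₂≡⌈j/2⌉ ⟨
        s + t₂ + (s + t₂)   ≡⟨ regroup s t₂ ⟩
        s + s + (t₂ + t₂)   ≤⟨ +-monoʳ-≤ (s + s) t₂+t₂≤m ⟩
        s + s + m           ≤⟨ +-monoˡ-≤ m (+-mono-≤ (m≤m+n s u) (m≤m+n s u)) ⟩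
        s + u + (s + u) + m ∎
        where
        regroup : ∀ s t → s + t + (s + t) ≡ s + s + (t + t)
        regroup = solve-∀
      2[s+u]<j : s + u + (s + u) < j
      2[s+u]<j = ≤-pred (≤-trans (1+[n+n]<m+m s+u<c) (⌈n/2⌉+⌈n/2⌉≤1+n j))
        where
        s+u<c : s + u < c
        s+u<c = subst (s + u <_) s+t₂≡⌈j/2⌉ (+-monoʳ-< s u<t₂)
      lo : 2 * p ≤ n + (d + d)
      lo = begin
        2 * p                      ≡⟨ cong (2 *_) p≡m+j+e ⟩
        2 * (m + j + e)            ≡⟨ 2p≡K+j m j e ⟩
        K + j                      ≤⟨ +-monoʳ-≤ K j≤2[s+u]+m ⟩
        K + (s + u + (s + u) + m)  ≡⟨ n+2d≡K+2[s+u]+m m j e s u ⟩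
        n + (d + d)                ∎
      hi : n + (d + d) < 2 * p + m
      hi = begin-strict
        n + (d + d)                ≡⟨ n+2d≡K+2[s+u]+m m j e s u ⟨
        K + (s + u + (s + u) + m)  <⟨ +-monoʳ-< K (+-monoˡ-< m 2[s+u]<j) ⟩
        K + (j + m)                ≡⟨ 2p+m≡K+[j+m] m j e ⟨
        2 * (m + j + e) + m        ≡⟨ cong (λ p → 2 * p + m) p≡m+j+e ⟨
        2 * p + m                  ∎

    ⌈e/2⌉+t₁≤e : ⌈ e /2⌉ + t₁ ≤ e
    ⌈e/2⌉+t₁≤e = ≤-trans (+-monoʳ-≤ ⌈ e /2⌉ (m⊓n≤m ⌊ e /2⌋ h))
                          (≤-reflexive (trans (+-comm ⌈ e /2⌉ ⌊ e /2⌋) (⌊n/2⌋+⌈n/2⌉≡n e)))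

    e+m≤m+e+s : e + m ≤ m + e + s
    e+m≤m+e+s = subst (_≤ m + e + s) (+-comm m e) (m≤m+n (m + e) s)

    m+e+s+t₂≤p : m + e + s + t₂ ≤ p
    m+e+s+t₂≤p = begin
      m + e + s + t₂    ≡⟨ +-assoc (m + e) s t₂ ⟩
      m + e + (s + t₂)  ≡⟨ cong (m + e +_) s+t₂≡⌈j/2⌉ ⟩
      m + e + ⌈ j /2⌉   ≤⟨ +-monoʳ-≤ (m + e) (⌈n/2⌉≤n j) ⟩
      m + e + j         ≡⟨ swap m e j ⟩
      m + j + e         ≡⟨ p≡m+j+e ⟨
      p                 ∎
      where
      open ≤-Reasoning
      swap : ∀ m e j → m + e + j ≡ m + j + e
      swap = solve-∀

    e+m≤p : e + m ≤ p
    e+m≤p = ≤-trans e+m≤m+e+s (≤-trans (m≤m+n _ t₂) m+e+s+t₂≤p)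

    row-count : ∑ p F + m + t₁ + t₂ ≤ p
    row-count = subst (_≤ p) ∑G≡ (∑-≤-length p (λ d _ → G≤1 d))
      where
      G₁ G₂ G : ℕ → ℕ
      G₁ d = F d + interval e m d
      G₂ d = G₁ d + interval ⌈ e /2⌉ t₁ d
      G  d = G₂ d + interval (m + e + s) t₂ d
      G₁≤1 : ∀ d → G₁ d ≤ 1
      G₁≤1 = +interval-≤1 F≤1 n+d-wraps
      G₂≤1 : ∀ d → G₂ d ≤ 1
      G₂≤1 = +interval-≤1 G₁≤1
               (Vanishes-+ {F} {interval e m} n+2d-wraps-once (interval-vanishes-before {b = e} {m} ⌈e/2⌉+t₁≤e))
      G≤1 : ∀ d → G d ≤ 1
      G≤1 = +interval-≤1 G₂≤1
              (Vanishes-+ {G₁} {interval ⌈ e /2⌉ t₁}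
                (Vanishes-+ {F} {interval e m} n+2d-wraps-twice (interval-vanishes-after {b = e} {m} e+m≤m+e+s))
                (interval-vanishes-after {b = ⌈ e /2⌉} {t₁} (≤-trans ⌈e/2⌉+t₁≤e (≤-trans (m≤m+n e m) e+m≤m+e+s))))
      ∑G≡ : ∑ p G ≡ ∑ p F + m + t₁ + t₂
      ∑G≡ = trans (∑-+interval p _ m+e+s+t₂≤p)
              (cong (_+ t₂) (trans (∑-+interval p _ (≤-trans ⌈e/2⌉+t₁≤e (≤-trans (m≤m+n e m) e+m≤p)))
                (cong (_+ t₁) (∑-+interval p F e+m≤p))))

    row-bound : 2 * ∑ p F + e ⊓ m + j ⊓ m ≤ 2 * (j + e) + 2
    row-bound = begin
      2 * ∑ p F + e ⊓ m + j ⊓ m                       ≤⟨ +-mono-≤ (+-monoʳ-≤ (2 * ∑ p F) e⊓m≤) j⊓m≤ ⟩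
      2 * ∑ p F + (1 + (t₁ + t₁)) + (1 + (t₂ + t₂))   ≡⟨ regroup (∑ p F) t₁ t₂ ⟩
      2 * (∑ p F + t₁ + t₂) + 2                       ≤⟨ +-monoˡ-≤ 2 (*-monoʳ-≤ 2 ∑F+t₁+t₂≤j+e) ⟩
      2 * (j + e) + 2                                 ∎
      where
      open ≤-Reasoning
      regroup : ∀ S a b → 2 * S + (1 + (a + a)) + (1 + (b + b)) ≡ 2 * (S + a + b) + 2
      regroup = solve-∀
      e⊓m≤ : e ⊓ m ≤ 1 + (t₁ + t₁)
      e⊓m≤ = ⊓-≤-1+double ⌊ e /2⌋ h (n≤1+⌊n/2⌋+⌊n/2⌋ e) (n≤1+⌊n/2⌋+⌊n/2⌋ m)
      j⊓m≤ : j ⊓ m ≤ 1 + (t₂ + t₂)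
      j⊓m≤ = ⊓-≤-1+double ⌈ j /2⌉ h (m≤n⇒m≤1+n (n≤⌈n/2⌉+⌈n/2⌉ j)) (n≤1+⌊n/2⌋+⌊n/2⌋ m)
      ∑F+t₁+t₂≤j+e : ∑ p F + t₁ + t₂ ≤ j + e
      ∑F+t₁+t₂≤j+e = +-cancelˡ-≤ m _ _ (begin
        m + (∑ p F + t₁ + t₂) ≡⟨ move-m m (∑ p F) t₁ t₂ ⟩
        ∑ p F + m + t₁ + t₂   ≤⟨ row-count ⟩
        p                     ≡⟨ trans p≡m+j+e (+-assoc m j e) ⟩
        m + (j + e)           ∎)
        where
        move-m : ∀ m S a b → m + (S + a + b) ≡ S + m + a + b
        move-m = solve-∀

  apCount≥ : (p : ℕ) .{{_ : NonZero p}} → ℕ → ℕ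
  apCount≥ p m = ∑[ n < p ] ∑[ d < p ] (χ≥ m n * χ≥ m ((n + d) % p) * χ≥ m ((n + (d + d)) % p))

  apCount≥-bound : ∀ p m k .{{_ : NonZero p}} → p ≡ m + k →
                   2 * apCount≥ p m + 4 * (p * k) ≤ 5 * (k * k) + p * p + p + k
  apCount≥-bound p m k p≡m+k = begin
    2 * N + 4 * (p * k)                                      ≡⟨ cong (λ p → 2 * N + 4 * (p * k)) p≡m+k ⟩
    2 * N + 4 * ((m + k) * k)                                ≡⟨ regroup N m k ⟩
    2 * N + 2 * m * k + (4 * (k * k) + 2 * m * k)            ≤⟨ +-monoˡ-≤ _ (+-monoʳ-≤ (2 * N) (2mk≤2∑⊓+m²+m m k)) ⟩
    2 * N + (2 * T + m * m + m) + (4 * (k * k) + 2 * m * k)  ≡⟨ regroup′ (2 * N) (2 * T) (m * m) m (4 * (k * k) + 2 * m * k) ⟩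
    2 * N + 2 * T + (m * m + m + (4 * (k * k) + 2 * m * k)) ≤⟨ +-monoˡ-≤ _ 2N+2T≤ ⟩
    k * (2 * k + 2) + (m * m + m + (4 * (k * k) + 2 * m * k)) ≡⟨ expand m k ⟩
    5 * (k * k) + (m + k) * (m + k) + (m + k) + k            ≡⟨ cong (λ p → 5 * (k * k) + p * p + p + k) p≡m+k ⟨
    5 * (k * k) + p * p + p + k                              ∎
    where
    open ≤-Reasoning
    N T R : ℕ
    N = apCount≥ p m
    T = ∑[ j < k ] (j ⊓ m)
    R = ∑[ j < k ] (suc j ⊓ m)

    H : ℕ → ℕ
    H n = ∑[ d < p ] (χ≥ m n * χ≥ m ((n + d) % p) * χ≥ m ((n + (d + d)) % p))

    rows : N ≡ ∑[ j < k ] H (m + j)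
    rows = trans (cong (λ p′ → ∑ p′ H) p≡m+k) (trans (∑-split m k H) (cong (_+ ∑[ j < k ] H (m + j))
             (∑-zero m (λ n n<m → ∑-zero p (λ d _ → cong (λ v → v * χ≥ m ((n + d) % p) * χ≥ m ((n + (d + d)) % p))
                                                         (χ≥-below n<m))))))

    row : ∀ j → j < k → 2 * H (m + j) + (k ∸ j) ⊓ m + j ⊓ m ≤ 2 * k + 2
    row j j<k = subst₂ (λ h k′ → 2 * h + (k ∸ j) ⊓ m + j ⊓ m ≤ 2 * k′ + 2) (sym H≡∑F) j+[k∸j]≡k row-bound
      where
      j+[k∸j]≡k : j + (k ∸ j) ≡ k
      j+[k∸j]≡k = m+[n∸m]≡n (<⇒≤ j<k)
      open Row p m j (k ∸ j) (trans p≡m+k (trans (cong (m +_) (sym j+[k∸j]≡k)) (sym (+-assoc m j (k ∸ j)))))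
      H≡∑F : H (m + j) ≡ ∑ p F
      H≡∑F = ∑-cong p (λ d _ →
        trans (cong (λ v → v * χ≥ m ((n + d) % p) * χ≥ m ((n + (d + d)) % p)) (χ≥-above (m≤m+n m j)))
              (cong (_* χ≥ m ((n + (d + d)) % p)) (*-identityˡ (χ≥ m ((n + d) % p)))))

    all-rows : 2 * N + R + T ≤ k * (2 * k + 2)
    all-rows = begin
      2 * N + R + T
        ≡⟨ cong₂ (λ a b → 2 * a + b + T) rows (sym (∑-reverse k (_⊓ m))) ⟩
      2 * ∑[ j < k ] H (m + j) + ∑[ j < k ] ((k ∸ j) ⊓ m) + T
        ≡⟨ cong (λ a → a + ∑[ j < k ] ((k ∸ j) ⊓ m) + T) (∑-distribˡ-* k 2 (λ j → H (m + j))) ⟨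
      ∑[ j < k ] (2 * H (m + j)) + ∑[ j < k ] ((k ∸ j) ⊓ m) + T
        ≡⟨ cong (_+ T) (∑-distrib-+ k (λ j → 2 * H (m + j)) (λ j → (k ∸ j) ⊓ m)) ⟨
      ∑[ j < k ] (2 * H (m + j) + (k ∸ j) ⊓ m) + T
        ≡⟨ ∑-distrib-+ k (λ j → 2 * H (m + j) + (k ∸ j) ⊓ m) (_⊓ m) ⟨
      ∑[ j < k ] (2 * H (m + j) + (k ∸ j) ⊓ m + j ⊓ m)
        ≤⟨ ∑-mono-≤ k row ⟩
      ∑[ _ < k ] (2 * k + 2)
        ≡⟨ ∑-const k (2 * k + 2) ⟩
      k * (2 * k + 2) ∎

    2N+2T≤ : 2 * N + 2 * T ≤ k * (2 * k + 2)
    2N+2T≤ = begin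
      2 * N + 2 * T  ≡⟨ double (2 * N) T ⟩
      2 * N + T + T  ≤⟨ +-monoˡ-≤ T (+-monoʳ-≤ (2 * N) (∑-mono-≤ k (λ j _ → ⊓-monoˡ-≤ m (n≤1+n j)))) ⟩
      2 * N + R + T  ≤⟨ all-rows ⟩
      k * (2 * k + 2) ∎
      where
      double : ∀ a t → a + 2 * t ≡ a + t + t
      double = solve-∀

    regroup : ∀ N m k → 2 * N + 4 * ((m + k) * k) ≡ 2 * N + 2 * m * k + (4 * (k * k) + 2 * m * k)
    regroup = solve-∀
    regroup′ : ∀ a b c d e → a + (b + c + d) + e ≡ a + b + (c + d + e)
    regroup′ = solve-∀
    expand : ∀ m k → k * (2 * k + 2) + (m * m + m + (4 * (k * k) + 2 * m * k))
                     ≡ 5 * (k * k) + (m + k) * (m + k) + (m + k) + k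
    expand = solve-∀


module Encoding where

  open import Data.Nat
  open import Data.Nat.Properties
  open import Data.Nat.DivMod using (%-distribˡ-+; m%n%n≡m%n)
  open import Data.Fin using (Fin; toℕ; zero; suc)
  open import Data.Fin.Properties using (toℕ-fromℕ<)
  open import Data.Fin.Subset using (Subset; Side; inside; outside; ∣_∣)
  open import Data.Vec using (_∷_; tabulate)
  open import Data.Vec.Properties using (lookup∘tabulate)
  open import Data.List using (map; allFin)
  import Data.List as List
  open import Data.List.Properties using (map-tabulate)
  open import Data.Nat.ListAction using (sum)
  open import Relation.Binary.PropositionalEquality
  open import Defs
  open Sums
  open Counting

  sum-tabulate : ∀ {n} (G : Fin n → ℕ) {g : ℕ → ℕ} → (∀ i → G i ≡ g (toℕ i)) → sum (List.tabulate G) ≡ ∑ n g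
  sum-tabulate {zero}  G eq = refl
  sum-tabulate {suc n} G eq = cong₂ _+_ (eq zero) (sum-tabulate (λ i → G (suc i)) (λ i → eq (suc i)))

  sum-map-allFin : ∀ {n} (G : Fin n → ℕ) {g : ℕ → ℕ} → (∀ i → G i ≡ g (toℕ i)) → sum (map G (allFin n)) ≡ ∑ n g
  sum-map-allFin G eq = trans (cong sum (map-tabulate (λ i → i) G)) (sum-tabulate G eq)

  ∣∷∣ : ∀ {n} x (xs : Subset n) → ∣ x ∷ xs ∣ ≡ ind x + ∣ xs ∣
  ∣∷∣ inside  xs = refl
  ∣∷∣ outside xs = refl

  ∣tabulate∣ : ∀ {n} (f : Fin n → Side) {g : ℕ → ℕ} → (∀ i → ind (f i) ≡ g (toℕ i)) → ∣ tabulate f ∣ ≡ ∑ n g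
  ∣tabulate∣ {zero}  f eq = refl
  ∣tabulate∣ {suc n} f eq = trans (∣∷∣ (f zero) (tabulate (λ i → f (suc i))))
                                 (cong₂ _+_ (eq zero) (∣tabulate∣ (λ i → f (suc i)) (λ i → eq (suc i))))

  toℕ-⊕ : ∀ {p} .{{_ : NonZero p}} (a b : Fin p) → toℕ (a ⊕ b) ≡ (toℕ a + toℕ b) % p
  toℕ-⊕ a b = toℕ-fromℕ< _

  [m+n%d]%d≡[m+n]%d : ∀ m n d .{{_ : NonZero d}} → (m + n % d) % d ≡ (m + n) % d
  [m+n%d]%d≡[m+n]%d m n d = begin
    (m + n % d) % d              ≡⟨ %-distribˡ-+ m (n % d) d ⟩
    (m % d + n % d % d) % d      ≡⟨ cong (λ v → (m % d + v) % d) (m%n%n≡m%n n d) ⟩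
    (m % d + n % d) % d          ≡⟨ %-distribˡ-+ m n d ⟨
    (m + n) % d                  ∎
    where open ≡-Reasoning

  atLeast : ∀ p → ℕ → Subset p
  atLeast p m = tabulate (λ i → side≥ m (toℕ i))

  𝟙-atLeast : ∀ {p} m (i : Fin p) → 𝟙 (atLeast p m) i ≡ χ≥ m (toℕ i)
  𝟙-atLeast m i = cong ind (lookup∘tabulate (λ i → side≥ m (toℕ i)) i)

  ∣atLeast∣ : ∀ p m k → p ≡ m + k → ∣ atLeast p m ∣ ≡ k
  ∣atLeast∣ p m k p≡m+k = begin
    ∣ atLeast p m ∣                        ≡⟨ ∣tabulate∣ {p} (λ i → side≥ m (toℕ i)) (λ _ → refl) ⟩
    ∑ p (χ≥ m)                             ≡⟨ cong (λ p → ∑ p (χ≥ m)) p≡m+k ⟩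
    ∑ (m + k) (χ≥ m)                       ≡⟨ ∑-split m k (χ≥ m) ⟩
    ∑ m (χ≥ m) + ∑[ j < k ] χ≥ m (m + j)   ≡⟨ cong₂ _+_ (∑-zero m (λ _ i<m → χ≥-below i<m))
                                                        (∑-cong k (λ j _ → χ≥-above (m≤m+n m j))) ⟩
    0 + ∑[ _ < k ] 1                       ≡⟨ trans (∑-const k 1) (*-identityʳ k) ⟩
    k                                      ∎
    where open ≡-Reasoning

  apCount-atLeast : ∀ p m .{{_ : NonZero p}} → apCount (atLeast p m) ≡ apCount≥ p m
  apCount-atLeast p m = sum-map-allFin _ (λ n → sum-map-allFin _ (λ d →
    cong₂ _*_ (cong₂ _*_ (𝟙-atLeast m n) (trans (𝟙-atLeast m (n ⊕ d)) (cong (χ≥ m) (toℕ-⊕ n d))))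
              (trans (𝟙-atLeast m (n ⊕ (d ⊕ d))) (cong (χ≥ m) (begin
                toℕ (n ⊕ (d ⊕ d))              ≡⟨ toℕ-⊕ n (d ⊕ d) ⟩
                (toℕ n + toℕ (d ⊕ d)) % p      ≡⟨ cong (λ v → (toℕ n + v) % p) (toℕ-⊕ d d) ⟩
                (toℕ n + (toℕ d + toℕ d) % p) % p ≡⟨ [m+n%d]%d≡[m+n]%d (toℕ n) (toℕ d + toℕ d) p ⟩
                (toℕ n + (toℕ d + toℕ d)) % p  ∎)))))
    where open ≡-Reasoning


module NatToℚ where

  open import Data.Nat using (ℕ; suc; NonZero)
  import Data.Nat as ℕ
  import Data.Nat.Properties as ℕ
  open import Data.Integer as ℤ using (+_)
  import Data.Integer.Properties as ℤ
  import Data.Integer.DivMod as ℤ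
  open import Data.Integer.Tactic.RingSolver using (solve-∀)
  open import Data.Rational hiding (NonZero)
  open import Data.Rational.Properties
  open import Data.Rational.Unnormalised as ℚᵘ using (ℚᵘ; mkℚᵘ; *≡*; *≤*; *<*)
  import Data.Rational.Unnormalised.Properties as ℚᵘ
  open import Data.Product using (Σ; _×_; _,_)
  open import Relation.Binary.PropositionalEquality

  fromℚᵘ-homo-+ : ∀ x y → fromℚᵘ (x ℚᵘ.+ y) ≡ fromℚᵘ x + fromℚᵘ y
  fromℚᵘ-homo-+ x y = toℚᵘ-injective (ℚᵘ.≃-trans (toℚᵘ-fromℚᵘ (x ℚᵘ.+ y))
    (ℚᵘ.≃-sym (ℚᵘ.≃-trans (toℚᵘ-homo-+ (fromℚᵘ x) (fromℚᵘ y))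
                          (ℚᵘ.+-cong (toℚᵘ-fromℚᵘ x) (toℚᵘ-fromℚᵘ y)))))

  fromℚᵘ-homo-* : ∀ x y → fromℚᵘ (x ℚᵘ.* y) ≡ fromℚᵘ x * fromℚᵘ y
  fromℚᵘ-homo-* x y = toℚᵘ-injective (ℚᵘ.≃-trans (toℚᵘ-fromℚᵘ (x ℚᵘ.* y))
    (ℚᵘ.≃-sym (ℚᵘ.≃-trans (toℚᵘ-homo-* (fromℚᵘ x) (fromℚᵘ y))
                          (ℚᵘ.*-cong (toℚᵘ-fromℚᵘ x) (toℚᵘ-fromℚᵘ y)))))

  fromℚᵘ-mono-≤ : ∀ {x y} → x ℚᵘ.≤ y → fromℚᵘ x ≤ fromℚᵘ y
  fromℚᵘ-mono-≤ {x} {y} x≤y =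
    toℚᵘ-cancel-≤ (ℚᵘ.≤-respʳ-≃ (ℚᵘ.≃-sym (toℚᵘ-fromℚᵘ y))
                    (ℚᵘ.≤-respˡ-≃ (ℚᵘ.≃-sym (toℚᵘ-fromℚᵘ x)) x≤y))

  fromℚᵘ-cancel-≤ : ∀ {x y} → fromℚᵘ x ≤ fromℚᵘ y → x ℚᵘ.≤ y
  fromℚᵘ-cancel-≤ {x} {y} x≤y =
    ℚᵘ.≤-respʳ-≃ (toℚᵘ-fromℚᵘ y) (ℚᵘ.≤-respˡ-≃ (toℚᵘ-fromℚᵘ x) (toℚᵘ-mono-≤ x≤y))

  ιᵘ : ℕ → ℚᵘ
  ιᵘ n = mkℚᵘ (+ n) 0

  ι : ℕ → ℚ
  ι n = + n / 1

  ι-+ : ∀ a b → ι (a ℕ.+ b) ≡ ι a + ι b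
  ι-+ a b = trans (fromℚᵘ-cong {ιᵘ (a ℕ.+ b)} {ιᵘ a ℚᵘ.+ ιᵘ b} (*≡* eq)) (fromℚᵘ-homo-+ (ιᵘ a) (ιᵘ b))
    where
    eq : + (a ℕ.+ b) ℤ.* + 1 ≡ (+ a ℤ.* + 1 ℤ.+ + b ℤ.* + 1) ℤ.* + 1
    eq = trans (cong (ℤ._* + 1) (ℤ.pos-+ a b)) (lemma (+ a) (+ b))
      where
      lemma : ∀ x y → (x ℤ.+ y) ℤ.* + 1 ≡ (x ℤ.* + 1 ℤ.+ y ℤ.* + 1) ℤ.* + 1
      lemma = solve-∀

  ι-* : ∀ a b → ι (a ℕ.* b) ≡ ι a * ι b
  ι-* a b = trans (fromℚᵘ-cong {ιᵘ (a ℕ.* b)} {ιᵘ a ℚᵘ.* ιᵘ b} (*≡* (cong (ℤ._* + 1) (ℤ.pos-* a b))))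
                  (fromℚᵘ-homo-* (ιᵘ a) (ιᵘ b))

  ι-mono-≤ : ∀ {a b} → a ℕ.≤ b → ι a ≤ ι b
  ι-mono-≤ {a} {b} a≤b = fromℚᵘ-mono-≤ {ιᵘ a} {ιᵘ b} (*≤* (ℤ.*-monoʳ-≤-nonNeg (+ 1) (ℤ.+≤+ a≤b)))

  ι-cancel-≤ : ∀ {a b} → ι a ≤ ι b → a ℕ.≤ b
  ι-cancel-≤ {a} {b} ιa≤ιb with fromℚᵘ-cancel-≤ {ιᵘ a} {ιᵘ b} ιa≤ιb
  ... | *≤* a*1≤b*1 = ℤ.drop‿+≤+ (subst₂ ℤ._≤_ (ℤ.*-identityʳ (+ a)) (ℤ.*-identityʳ (+ b)) a*1≤b*1)

  ι-nonNeg : ∀ n → 0ℚ ≤ ι n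
  ι-nonNeg n = ι-mono-≤ {0} {n} ℕ.z≤n

  0≤1/p : ∀ p .{{_ : NonZero p}} → 0ℚ ≤ + 1 / p
  0≤1/p p = nonNegative⁻¹ (+ 1 / p) {{normalize-nonNeg 1 p}}

  ι[p]*1/p≡1 : ∀ p .{{_ : NonZero p}} → ι p * (+ 1 / p) ≡ 1ℚ
  ι[p]*1/p≡1 p@(suc p′) = trans (sym (fromℚᵘ-homo-* (ιᵘ p) εᵘ))
                                (fromℚᵘ-cong {ιᵘ p ℚᵘ.* εᵘ} {ιᵘ 1} (*≡* eq))
    where
    εᵘ : ℚᵘ
    εᵘ = mkℚᵘ (+ 1) p′
    lemma : ∀ p → p ℤ.* + 1 ℤ.* + 1 ≡ + 1 ℤ.* (+ 1 ℤ.* p)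
    lemma = solve-∀
    eq : (+ p ℤ.* + 1) ℤ.* + 1 ≡ + 1 ℤ.* + (1 ℕ.* p)
    eq = trans (lemma (+ p)) (cong (+ 1 ℤ.*_) (ℤ.pos-* 1 p))

  n/p²≡ι[n]*1/p*1/p : ∀ n p .{{_ : NonZero p}} → _/_ (+ n) (p ℕ.* p) {{ℕ.m*n≢0 p p}} ≡ ι n * (+ 1 / p) * (+ 1 / p)
  n/p²≡ι[n]*1/p*1/p n p@(suc p′) =
    trans (fromℚᵘ-cong {mkℚᵘ (+ n) (p′ ℕ.+ p′ ℕ.* p)} {ιᵘn*εᵘ ℚᵘ.* εᵘ} (*≡* eq))
          (trans (fromℚᵘ-homo-* ιᵘn*εᵘ εᵘ) (cong (_* (+ 1 / p)) (fromℚᵘ-homo-* (ιᵘ n) εᵘ)))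
    where
    εᵘ : ℚᵘ
    εᵘ = mkℚᵘ (+ 1) p′
    ιᵘn*εᵘ : ℚᵘ
    ιᵘn*εᵘ = ιᵘ n ℚᵘ.* εᵘ
    lemma : ∀ n p → n ℤ.* (+ 1 ℤ.* p ℤ.* p) ≡ (n ℤ.* + 1 ℤ.* + 1) ℤ.* (p ℤ.* p)
    lemma = solve-∀
    eq : + n ℤ.* + (1 ℕ.* p ℕ.* p) ≡ (+ n ℤ.* + 1 ℤ.* + 1) ℤ.* + (p ℕ.* p)
    eq = begin
      + n ℤ.* + (1 ℕ.* p ℕ.* p)
        ≡⟨ cong (+ n ℤ.*_) (trans (ℤ.pos-* (1 ℕ.* p) p) (cong (ℤ._* + p) (ℤ.pos-* 1 p))) ⟩
      + n ℤ.* (+ 1 ℤ.* + p ℤ.* + p)            ≡⟨ lemma (+ n) (+ p) ⟩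
      (+ n ℤ.* + 1 ℤ.* + 1) ℤ.* (+ p ℤ.* + p)  ≡⟨ cong ((+ n ℤ.* + 1 ℤ.* + 1) ℤ.*_) (ℤ.pos-* p p) ⟨
      (+ n ℤ.* + 1 ℤ.* + 1) ℤ.* + (p ℕ.* p)    ∎
      where open ≡-Reasoning

  floor-nonNeg : ∀ q → 0ℚ ≤ q → Σ ℕ λ k → (+ k ≡ floor q) × (ι k ≤ q) × (q < ι k + 1ℚ)
  floor-nonNeg q@(mkℚ n d-1 _) 0≤q = k , +k≡⌊q⌋ , ι[k]≤q , q<ι[k]+1
    where
    d : ℤ.ℤ
    d = + suc d-1
    k : ℕ
    k = ℤ.∣ n ℤ./ d ∣
    0≤n : + 0 ℤ.≤ n
    0≤n with drop-*≤* 0≤q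
    ... | 0≤n*1 = subst (+ 0 ℤ.≤_) (ℤ.*-identityʳ n) 0≤n*1
    +k≡⌊q⌋ : + k ≡ n ℤ./ d
    +k≡⌊q⌋ = ℤ.0≤i⇒+∣i∣≡i (ℤ.0≤n⇒0≤n/d n d 0≤n (ℤ.+≤+ ℕ.z≤n))
    ι[k]≤q : ι k ≤ q
    ι[k]≤q = toℚᵘ-cancel-≤ (ℚᵘ.≤-respˡ-≃ (ℚᵘ.≃-sym (toℚᵘ-fromℚᵘ (ιᵘ k)))
               (*≤* (subst₂ ℤ._≤_ (cong (ℤ._* d) (sym +k≡⌊q⌋)) (sym (ℤ.*-identityʳ n)) (ℤ.[n/d]*d≤n n d))))
    n<[1+k]*d : n ℤ.< (+ 1 ℤ.+ + k) ℤ.* d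
    n<[1+k]*d = subst₂ ℤ._<_ (sym (ℤ.a≡a%n+[a/n]*n n d))
                  (trans (lemma (n ℤ./ d) d) (cong (λ z → (+ 1 ℤ.+ z) ℤ.* d) (sym +k≡⌊q⌋)))
                  (ℤ.+-monoˡ-< ((n ℤ./ d) ℤ.* d) (ℤ.+<+ (ℤ.n%d<d n d)))
      where
      lemma : ∀ z d → d ℤ.+ z ℤ.* d ≡ (+ 1 ℤ.+ z) ℤ.* d
      lemma = solve-∀
    q<ι[k]+1 : q < ι k + 1ℚ
    q<ι[k]+1 = subst (q <_) (trans (cong ι (ℕ.+-comm 1 k)) (ι-+ k 1))
                 (toℚᵘ-cancel-< (ℚᵘ.<-respʳ-≃ (ℚᵘ.≃-sym (toℚᵘ-fromℚᵘ (ιᵘ (suc k))))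
                   (*<* (subst₂ ℤ._<_ (sym (ℤ.*-identityʳ n)) (cong (ℤ._* d) (sym (ℤ.pos-+ 1 k))) n<[1+k]*d))))


module Estimate where

  open import Data.Integer using (+_)
  open import Data.Rational
  open import Data.Rational.Properties
  open import Data.List using (_∷_; [])
  open import Data.Maybe using (map)
  open import Level using (0ℓ)
  open import Relation.Binary.PropositionalEquality using (_≡_; sym; subst; cong; trans)
  open import Relation.Nullary.Decidable using (dec⇒maybe)
  open import Tactic.RingSolver using (solve)
  import Tactic.RingSolver.Core.AlmostCommutativeRing as ACR

  ℚ-ring : ACR.AlmostCommutativeRing 0ℓ 0ℓ
  ℚ-ring = ACR.fromCommutativeRing +-*-commutativeRing (λ x → map sym (dec⇒maybe (x ≟ 0ℚ)))

  +-nonNeg : ∀ {p q} → 0ℚ ≤ p → 0ℚ ≤ q → 0ℚ ≤ p + q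
  +-nonNeg 0≤p 0≤q = +-mono-≤ 0≤p 0≤q

  *-nonNeg : ∀ {p q} → 0ℚ ≤ p → 0ℚ ≤ q → 0ℚ ≤ p * q
  *-nonNeg {p} {q} 0≤p 0≤q = nonNegative⁻¹ _ {{nonNeg*nonNeg⇒nonNeg p {{nonNegative 0≤p}} q {{nonNegative 0≤q}}}}

  p≤q⇒0≤q-p : ∀ {p q} → p ≤ q → 0ℚ ≤ q - p
  p≤q⇒0≤q-p {p} {q} p≤q = subst (_≤ q - p) (+-inverseʳ p) (+-monoˡ-≤ (- p) p≤q)

  p≤p+q : ∀ {p q} → 0ℚ ≤ q → p ≤ p + q
  p≤p+q {p} 0≤q = subst (_≤ p + _) (+-identityʳ p) (+-monoʳ-≤ p 0≤q)

  f : ℚ → ℚ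
  f α = α * α * α * (1ℚ - (1ℚ - α) * (1ℚ - α) * (+ 1 / 2))

  q : ℚ → ℚ
  q x = (+ 5 / 1) * (x * x) - (+ 4 / 1) * x + 1ℚ

  q≤2f : ∀ {α} → + 2 / 3 ≤ α → α ≤ 1ℚ → q α ≤ (+ 2 / 1) * f α
  q≤2f {α} 2/3≤α α≤1 = begin
    q α                                              ≤⟨ p≤p+q (*-nonNeg (*-nonNeg (*-nonNeg 0≤1-α 0≤1-α) 0≤1-α)
                                                                        (+-nonNeg 0≤3α-2 (*-nonNeg 0≤1-α 0≤1-α))) ⟩
    q α + (1ℚ - α) * (1ℚ - α) * (1ℚ - α) * ((+ 3 / 1) * α - (+ 2 / 1) + (1ℚ - α) * (1ℚ - α))
                                                     ≡⟨ q+gap≡2f ⟩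
    (+ 2 / 1) * f α                                  ∎
    where
    open ≤-Reasoning
    -- Identities handed to `solve` spell out q and f: the solver does not unfold definitions.
    q+gap≡2f : (+ 5 / 1) * (α * α) - (+ 4 / 1) * α + 1ℚ
               + (1ℚ - α) * (1ℚ - α) * (1ℚ - α) * ((+ 3 / 1) * α - (+ 2 / 1) + (1ℚ - α) * (1ℚ - α))
               ≡ (+ 2 / 1) * (α * α * α * (1ℚ - (1ℚ - α) * (1ℚ - α) * (+ 1 / 2)))
    q+gap≡2f = solve (α ∷ []) ℚ-ring
    0≤1-α : 0ℚ ≤ 1ℚ - α
    0≤1-α = p≤q⇒0≤q-p α≤1
    0≤3α-2 : 0ℚ ≤ (+ 3 / 1) * α - (+ 2 / 1)
    0≤3α-2 = subst (0ℚ ≤_) 3[α-2/3]≡3α-2 (*-nonNeg (nonNegative⁻¹ (+ 3 / 1)) (p≤q⇒0≤q-p 2/3≤α))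
      where
      3[α-2/3]≡3α-2 : (+ 3 / 1) * (α - + 2 / 3) ≡ (+ 3 / 1) * α - (+ 2 / 1)
      3[α-2/3]≡3α-2 = solve (α ∷ []) ℚ-ring

  q-shift : ∀ {α x ε} → 0ℚ ≤ x → x ≤ α → α ≤ x + ε → q x ≤ q α + (+ 4 / 1) * ε
  q-shift {α} {x} {ε} 0≤x x≤α α≤x+ε = begin
    q x                                                            ≤⟨ p≤p+q gap≥0 ⟩
    q x + ((α - x) * ((+ 5 / 1) * α + (+ 5 / 1) * x) + (+ 4 / 1) * (x + ε - α)) ≡⟨ q+gap≡ ⟩
    q α + (+ 4 / 1) * ε                                            ∎
    where
    open ≤-Reasoning
    q+gap≡ : (+ 5 / 1) * (x * x) - (+ 4 / 1) * x + 1ℚ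
             + ((α - x) * ((+ 5 / 1) * α + (+ 5 / 1) * x) + (+ 4 / 1) * (x + ε - α))
             ≡ (+ 5 / 1) * (α * α) - (+ 4 / 1) * α + 1ℚ + (+ 4 / 1) * ε
    q+gap≡ = solve (α ∷ x ∷ ε ∷ []) ℚ-ring
    0≤5 : 0ℚ ≤ + 5 / 1
    0≤5 = nonNegative⁻¹ _
    gap≥0 : 0ℚ ≤ (α - x) * ((+ 5 / 1) * α + (+ 5 / 1) * x) + (+ 4 / 1) * (x + ε - α)
    gap≥0 = +-nonNeg (*-nonNeg (p≤q⇒0≤q-p x≤α) (+-nonNeg (*-nonNeg 0≤5 (≤-trans 0≤x x≤α)) (*-nonNeg 0≤5 0≤x)))
                     (*-nonNeg (nonNegative⁻¹ (+ 4 / 1)) (p≤q⇒0≤q-p α≤x+ε))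

  density-bound : ∀ {α x ε L} → + 2 / 3 ≤ α → α ≤ 1ℚ → 0ℚ ≤ x → x ≤ α → α ≤ x + ε →
                  (+ 2 / 1) * L + (+ 4 / 1) * x ≤ (+ 5 / 1) * (x * x) + 1ℚ + ε + x * ε →
                  L ≤ f α + (+ 3 / 1) * ε
  density-bound {α} {x} {ε} {L} 2/3≤α α≤1 0≤x x≤α α≤x+ε scaled = *-cancelˡ-≤-pos (+ 2 / 1) (begin
    (+ 2 / 1) * L                                                          ≡⟨ add-sub ((+ 2 / 1) * L) ((+ 4 / 1) * x) ⟩
    (+ 2 / 1) * L + (+ 4 / 1) * x - (+ 4 / 1) * x                          ≤⟨ +-monoˡ-≤ (- ((+ 4 / 1) * x)) scaled ⟩
    (+ 5 / 1) * (x * x) + 1ℚ + ε + x * ε - (+ 4 / 1) * x                   ≡⟨ regroup-q ⟩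
    q x + (ε + x * ε)                                                      ≤⟨ +-mono-≤ (q-shift 0≤x x≤α α≤x+ε) (+-monoʳ-≤ ε xε≤ε) ⟩
    q α + (+ 4 / 1) * ε + (ε + ε)                                          ≤⟨ +-monoˡ-≤ (ε + ε) (+-monoˡ-≤ ((+ 4 / 1) * ε) (q≤2f 2/3≤α α≤1)) ⟩
    (+ 2 / 1) * f α + (+ 4 / 1) * ε + (ε + ε)                              ≡⟨ factor-2 (f α) ε ⟩
    (+ 2 / 1) * (f α + (+ 3 / 1) * ε)                                      ∎)
    where
    open ≤-Reasoning
    add-sub : ∀ a b → a ≡ a + b - b
    add-sub a b = solve (a ∷ b ∷ []) ℚ-ring
    regroup-q : (+ 5 / 1) * (x * x) + 1ℚ + ε + x * ε - (+ 4 / 1) * x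
                ≡ (+ 5 / 1) * (x * x) - (+ 4 / 1) * x + 1ℚ + (ε + x * ε)
    regroup-q = solve (x ∷ ε ∷ []) ℚ-ring
    factor-2 : ∀ a e → (+ 2 / 1) * a + (+ 4 / 1) * e + (e + e) ≡ (+ 2 / 1) * (a + (+ 3 / 1) * e)
    factor-2 a e = solve (a ∷ e ∷ []) ℚ-ring
    0≤ε : 0ℚ ≤ ε
    0≤ε = ≤-trans (p≤q⇒0≤q-p x≤α) (≤-trans (+-monoˡ-≤ (- x) α≤x+ε) (≤-reflexive x+ε-x≡ε))
      where
      x+ε-x≡ε : x + ε - x ≡ ε
      x+ε-x≡ε = solve (x ∷ ε ∷ []) ℚ-ring
    xε≤ε : x * ε ≤ ε
    xε≤ε = ≤-trans (*-monoʳ-≤-nonNeg ε {{nonNegative 0≤ε}} (≤-trans x≤α α≤1)) (≤-reflexive (*-identityˡ ε))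

  divide-by-P² : ∀ {N P k ε} → P * ε ≡ 1ℚ → 0ℚ ≤ ε →
                 (+ 2 / 1) * N + (+ 4 / 1) * (P * k) ≤ (+ 5 / 1) * (k * k) + P * P + P + k →
                 (+ 2 / 1) * (N * ε * ε) + (+ 4 / 1) * (k * ε) ≤ (+ 5 / 1) * ((k * ε) * (k * ε)) + 1ℚ + ε + (k * ε) * ε
  divide-by-P² {N} {P} {k} {ε} Pε≡1 0≤ε bound = begin
    (+ 2 / 1) * (N * ε * ε) + (+ 4 / 1) * (k * ε)                      ≡⟨ lhs ⟨
    ((+ 2 / 1) * N + (+ 4 / 1) * (P * k)) * (ε * ε)                    ≤⟨ *-monoʳ-≤-nonNeg (ε * ε) {{nonNegative (*-nonNeg 0≤ε 0≤ε)}} bound ⟩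
    ((+ 5 / 1) * (k * k) + P * P + P + k) * (ε * ε)                    ≡⟨ rhs ⟩
    (+ 5 / 1) * ((k * ε) * (k * ε)) + 1ℚ + ε + (k * ε) * ε             ∎
    where
    open ≤-Reasoning
    lhs : ((+ 2 / 1) * N + (+ 4 / 1) * (P * k)) * (ε * ε) ≡ (+ 2 / 1) * (N * ε * ε) + (+ 4 / 1) * (k * ε)
    lhs = trans expand (trans (cong (λ t → (+ 2 / 1) * (N * ε * ε) + (+ 4 / 1) * t * (k * ε)) Pε≡1) drop-1)
      where
      expand : ((+ 2 / 1) * N + (+ 4 / 1) * (P * k)) * (ε * ε) ≡ (+ 2 / 1) * (N * ε * ε) + (+ 4 / 1) * (P * ε) * (k * ε)
      expand = solve (N ∷ P ∷ k ∷ ε ∷ []) ℚ-ring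
      drop-1 : (+ 2 / 1) * (N * ε * ε) + (+ 4 / 1) * 1ℚ * (k * ε) ≡ (+ 2 / 1) * (N * ε * ε) + (+ 4 / 1) * (k * ε)
      drop-1 = solve (N ∷ k ∷ ε ∷ []) ℚ-ring
    rhs : ((+ 5 / 1) * (k * k) + P * P + P + k) * (ε * ε) ≡ (+ 5 / 1) * ((k * ε) * (k * ε)) + 1ℚ + ε + (k * ε) * ε
    rhs = trans expand (trans (cong (λ t → (+ 5 / 1) * ((k * ε) * (k * ε)) + t * t + t * ε + (k * ε) * ε) Pε≡1) drop-1)
      where
      expand : ((+ 5 / 1) * (k * k) + P * P + P + k) * (ε * ε)
               ≡ (+ 5 / 1) * ((k * ε) * (k * ε)) + (P * ε) * (P * ε) + (P * ε) * ε + (k * ε) * ε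
      expand = solve (P ∷ k ∷ ε ∷ []) ℚ-ring
      drop-1 : (+ 5 / 1) * ((k * ε) * (k * ε)) + 1ℚ * 1ℚ + 1ℚ * ε + (k * ε) * ε
               ≡ (+ 5 / 1) * ((k * ε) * (k * ε)) + 1ℚ + ε + (k * ε) * ε
      drop-1 = solve (k ∷ ε ∷ []) ℚ-ring


open import Defs
open import Data.Nat using (ℕ; NonZero)
open import Data.Nat.Divisibility using (_∣_)
open import Data.Nat.Primality using (Prime)
open import Data.Fin.Subset using (Subset; ∣_∣)
open import Data.Integer using (+_)
open import Data.Product using (Σ; ∃; _×_)
open import Relation.Binary.PropositionalEquality using (_≡_)
open import Relation.Nullary using (¬_)
open import Data.Rational using (ℚ; _/_; _+_; _-_; _*_; _<_; _≤_; floor; 1ℚ)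

import Data.Nat as ℕ
import Data.Nat.Properties as ℕ
open import Data.Product using (_,_)
open import Data.Rational using (NonNegative; nonNegative)
open import Data.Rational.Properties
  using (≤-trans; <⇒≤; *-monoʳ-≤-nonNeg; *-identityˡ; *-assoc; *-identityʳ; *-distribʳ-+; nonNegative⁻¹)
open import Relation.Binary.PropositionalEquality using (sym; trans; cong; cong₂; subst; subst₂)
open Counting using (apCount≥; apCount≥-bound)
open Encoding using (atLeast; ∣atLeast∣; apCount-atLeast)
open NatToℚ
open Estimate using (f; density-bound; divide-by-P²; *-nonNeg)

ι-mono-progression-bound : ∀ {N p k} →
                           2 ℕ.* N ℕ.+ 4 ℕ.* (p ℕ.* k) ℕ.≤ 5 ℕ.* (k ℕ.* k) ℕ.+ p ℕ.* p ℕ.+ p ℕ.+ k →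
                           (+ 2 / 1) * ι N + (+ 4 / 1) * (ι p * ι k) ≤ (+ 5 / 1) * (ι k * ι k) + ι p * ι p + ι p + ι k
ι-mono-progression-bound {N} {p} {k} bound = subst₂ _≤_ lhs rhs (ι-mono-≤ bound)
  where
  lhs : ι (2 ℕ.* N ℕ.+ 4 ℕ.* (p ℕ.* k)) ≡ (+ 2 / 1) * ι N + (+ 4 / 1) * (ι p * ι k)
  lhs = trans (ι-+ (2 ℕ.* N) (4 ℕ.* (p ℕ.* k)))
              (cong₂ _+_ (ι-* 2 N) (trans (ι-* 4 (p ℕ.* k)) (cong ((+ 4 / 1) *_) (ι-* p k))))
  rhs : ι (5 ℕ.* (k ℕ.* k) ℕ.+ p ℕ.* p ℕ.+ p ℕ.+ k) ≡ (+ 5 / 1) * (ι k * ι k) + ι p * ι p + ι p + ι k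
  rhs = trans (ι-+ (5 ℕ.* (k ℕ.* k) ℕ.+ p ℕ.* p ℕ.+ p) k) (cong (_+ ι k)
          (trans (ι-+ (5 ℕ.* (k ℕ.* k) ℕ.+ p ℕ.* p) p) (cong (_+ ι p)
            (trans (ι-+ (5 ℕ.* (k ℕ.* k)) (p ℕ.* p))
              (cong₂ _+_ (trans (ι-* 5 (k ℕ.* k)) (cong ((+ 5 / 1) *_) (ι-* k k))) (ι-* p p))))))

interval-Λ-bound : ∀ p .{{_ : NonZero p}} α → + 2 / 3 ≤ α → α ≤ 1ℚ →
                   Σ (Subset p) λ S → (+ ∣ S ∣ ≡ floor (α * ι p)) × (Λ S ≤ f α + (+ 3 / 1) * (+ 1 / p))
interval-Λ-bound p α 2/3≤α α≤1
  with floor-nonNeg (α * ι p) (*-nonNeg (≤-trans (nonNegative⁻¹ (+ 2 / 3)) 2/3≤α) (ι-nonNeg p))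
... | k , +k≡⌊αp⌋ , k≤αp , αp<k+1 = atLeast p m , trans (cong +_ (∣atLeast∣ p m k p≡m+k)) +k≡⌊αp⌋ , Λ≤
  where
  ε x : ℚ
  ε = + 1 / p
  x = ι k * ε
  instance
    ε-nonNeg : NonNegative ε
    ε-nonNeg = nonNegative (0≤1/p p)
  αp≤p : α * ι p ≤ ι p
  αp≤p = subst (α * ι p ≤_) (*-identityˡ (ι p)) (*-monoʳ-≤-nonNeg (ι p) {{nonNegative (ι-nonNeg p)}} α≤1)
  k≤p : k ℕ.≤ p
  k≤p = ι-cancel-≤ (≤-trans k≤αp αp≤p)
  m : ℕ
  m = p ℕ.∸ k
  p≡m+k : p ≡ m ℕ.+ k
  p≡m+k = sym (ℕ.m∸n+n≡m k≤p)
  N : ℕ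
  N = apCount≥ p m
  αpε≡α : α * ι p * ε ≡ α
  αpε≡α = trans (*-assoc α (ι p) ε) (trans (cong (α *_) (ι[p]*1/p≡1 p)) (*-identityʳ α))
  x≤α : x ≤ α
  x≤α = subst (x ≤_) αpε≡α (*-monoʳ-≤-nonNeg ε k≤αp)
  α≤x+ε : α ≤ x + ε
  α≤x+ε = subst₂ _≤_ αpε≡α (trans (*-distribʳ-+ ε (ι k) 1ℚ) (cong (_+_ x) (*-identityˡ ε)))
                    (*-monoʳ-≤-nonNeg ε (<⇒≤ αp<k+1))
  Λ≡ : Λ (atLeast p m) ≡ ι N * ε * ε
  Λ≡ = trans (cong (λ n → _/_ (+ n) (p ℕ.* p) {{ℕ.m*n≢0 p p}}) (apCount-atLeast p m)) (n/p²≡ι[n]*1/p*1/p N p)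
  Λ≤ : Λ (atLeast p m) ≤ f α + (+ 3 / 1) * ε
  Λ≤ = subst (_≤ f α + (+ 3 / 1) * ε) (sym Λ≡)
         (density-bound 2/3≤α α≤1 (*-nonNeg (ι-nonNeg k) (0≤1/p p)) x≤α α≤x+ε
           (divide-by-P² {ι N} {ι p} {ι k} (ι[p]*1/p≡1 p) (0≤1/p p)
             (ι-mono-progression-bound {N} {p} {k} (apCount≥-bound p m k p≡m+k))))

lemma3 : Σ ℚ λ C → ∀ (p : ℕ) .{{_ : NonZero p}} → Prime p → ¬ (2 ∣ p)
           → ∀ (α : ℚ) → (+ 2 / 3) < α → α ≤ 1ℚ
           → Σ (Subset p) λ S → (+ ∣ S ∣ ≡ floor (α * (+ p / 1)))
               × (Λ S ≤ α * α * α * (1ℚ - (1ℚ - α) * (1ℚ - α) * (+ 1 / 2)) + C * (+ 1 / p))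
lemma3 = + 3 / 1 , λ p _ _ α 2/3<α α≤1 → interval-Λ-bound p α (<⇒≤ 2/3<α) α≤1
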